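{- For each positive integer $n$ write $H_n=1+\frac12+\cdots+\frac1n=c_n/d_n$ in lowest terms, let $D_n=\mathrm{lcm}(1,2,\ldots,n)$, and let $q_n=D_n/d_n$. Let $2<p_1<p_2<\cdots<p_k$ be prime numbers. Then there exists a positive integer $n$ such that $p_1p_2\cdots p_k\mid q_n$.
   Context: $H_n=c_n/d_n$ with $\gcd(c_n,d_n)=1$; $D_n=\mathrm{lcm}(1,\ldots,n)$; $q_n=D_n/d_n$. -}

module Defs where

open import Data.Nat using (ℕ; zero; suc)
open import Data.Nat.DivMod using (_/_)
open import Data.Nat.LCM using (lcm)
open import Data.Integer using (+_)
open import Data.Rational using (ℚ; 0ℚ; _+_; ↧ₙ_)
import Data.Rational as ℚ

-- 1/i as a rational, for i ≥ 1 (written with successor to avoid a NonZero side condition)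
recipSuc : ℕ → ℚ
recipSuc i = (+ 1) ℚ./ suc i

H : ℕ → ℚ
H zero    = 0ℚ
H (suc n) = H n + recipSuc n

-- d n = denominator of H n in lowest terms (ℚ is always normalised)
d : ℕ → ℕ
d n = ↧ₙ (H n)

D : ℕ → ℕ
D zero    = 1
D (suc n) = lcm (D n) (suc n)

-- q n = D n / d n  (d n ∣ D n, so this is exact division; d n ≥ 1)
q : ℕ → ℕ
q n = D n / d n

{-# OPTIONS --safe #-}
-- If (p − 1) p^k ≤ n < p^(k+1) with k ≥ 1 for an odd prime p, then p divides D_n and also the
-- numerator ∑ D_n / i of H_n = (∑ D_n / i) / D_n: a term with p^k ∤ i is divisible by p, and the
-- remaining terms i = j p^k, 1 ≤ j ≤ p − 1, cancel modulo p in pairs j ↔ p − j.  A common factor of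
-- numerator and denominator survives in D_n / d_n = q_n.  So it suffices to find one n lying in such
-- a window for every p_i.  Pigeonholing the leading digits of p^⌈log_p b^a⌉ / b^a over all p_i at
-- once yields G and exponents F_p with every p^(F_p) within a factor 1 + 1/(2p) of b^G; then
-- n = min(b^G, p^(F_p)) − 1 lies in all the windows.
module Submission where

open import Defs
open import Data.Nat using (ℕ; _<_)
open import Data.Nat.Divisibility using (_∣_)
open import Data.Nat.ListAction using (product)
open import Data.Nat.Primality using (Prime)
open import Data.List using (List)
open import Data.List.Relation.Unary.All using (All)
open import Data.List.Relation.Unary.Linked using (Linked)
open import Data.Product using (∃; _×_)

open import Data.Empty using (⊥-elim)
open import Data.Fin.Base using (toℕ; fromℕ<)
open import Data.Fin.Properties using (pigeonhole; toℕ-fromℕ<)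
import Data.Integer as ℤ
import Data.Integer.Properties as ℤ
open import Data.List.Base using ([]; _∷_; map)
open import Data.List.Extrema.Nat using (min; argmin-all; min≤xs; v<min⁺; max; xs≤max)
open import Data.List.Membership.Propositional using (_∈_)
import Data.List.Relation.Unary.All as All
open import Data.List.Relation.Unary.All using ([]; _∷_)
open import Data.List.Relation.Unary.All.Properties using (map⁺; map⁻)
import Data.List.Relation.Unary.AllPairs as AllPairs
open import Data.List.Relation.Unary.AllPairs using (AllPairs; []; _∷_)
open import Data.List.Relation.Unary.Linked.Properties using (Linked⇒AllPairs)
open import Data.Nat.Base
open import Data.Nat.Coprimality as Coprimality using (Coprime; coprime-divisor)
open import Data.Nat.Divisibility
open import Data.Nat.DivMod
  using (_/_; _%_; m≡m%n+[m/n]*n; m%n<n; m/n*n≤m; m/n*n≡m; m*n/n≡m; m/n/o≡m/[n*o]; /-congʳ; /-monoˡ-≤;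
         m<n*o⇒m/o<n; [m+kn]%n≡m%n; m<n⇒m%n≡m)
open import Data.Nat.LCM using (lcm; m∣lcm[m,n]; n∣lcm[m,n]; gcd*lcm)
open import Data.Nat.GCD using (gcd)
open import Data.Nat.Primality using (prime⇒irreducible; prime⇒nonZero; prime⇒nonTrivial; euclidsLemma)
open import Data.Nat.Properties
open import Algebra.Properties.CommutativeSemigroup +-commutativeSemigroup using (interchange)
open import Algebra.Properties.CommutativeSemigroup *-commutativeSemigroup
  using (x∙yz≈y∙xz; x∙yz≈yx∙z; xy∙z≈y∙xz; xy∙z≈x∙zy; xy∙z≈xz∙y)
open import Data.Nat.Tactic.RingSolver using (solve-∀)
open import Data.Product using (∃₂; _,_; proj₁; proj₂)
open import Data.Rational using (ℚ; mkℚ; ↥_; ↧_; ↧ₙ_; toℚᵘ)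
open import Data.Rational.Properties using (toℚᵘ-homo-+; toℚᵘ-fromℚᵘ; ↥ᵘ-toℚᵘ; ↧ᵘ-toℚᵘ)
import Data.Rational.Unnormalised as ℚᵘ
open import Data.Rational.Unnormalised using (mkℚᵘ; *≡*; _≃_)
open import Data.Rational.Unnormalised.Properties using (≃-trans) renaming (+-cong to +ᵘ-cong)
open import Data.Sum using (inj₁; inj₂; [_,_]′)
open import Function using (id)
open import Relation.Nullary using (¬_; yes; no)
open import Relation.Binary.PropositionalEquality

-- Finite sums

infixl 7 _÷_

-- Division made total by the junk value m ÷ 0 = 0; it only ever meets positive divisors.
_÷_ : ℕ → ℕ → ℕ
m ÷ zero  = 0
m ÷ suc n = m / suc n

∑ : ℕ → (ℕ → ℕ) → ℕ
∑ zero    f = 0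
∑ (suc n) f = ∑ n f + f (suc n)

syntax ∑ n (λ i → e) = ∑[ i ≤ n ] e

∑-+ : ∀ m n f → ∑ (m + n) f ≡ ∑ m f + ∑[ t ≤ n ] f (m + t)
∑-+ m zero    f rewrite +-identityʳ m = sym (+-identityʳ (∑ m f))
∑-+ m (suc n) f rewrite +-suc m n | ∑-+ m n f = +-assoc (∑ m f) _ _

∑-distrib : ∀ n f g → ∑[ t ≤ n ] (f t + g t) ≡ ∑ n f + ∑ n g
∑-distrib zero    f g = refl
∑-distrib (suc n) f g rewrite ∑-distrib n f g = interchange (∑ n f) (∑ n g) (f (suc n)) (g (suc n))

∑-cong : ∀ n {f g} → (∀ t → f t ≡ g t) → ∑ n f ≡ ∑ n g
∑-cong zero    f≡g = refl
∑-cong (suc n) f≡g = cong₂ _+_ (∑-cong n f≡g) (f≡g (suc n))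

∑-unfoldˡ : ∀ n f → ∑ (suc n) f ≡ f 1 + ∑[ t ≤ n ] f (suc t)
∑-unfoldˡ zero    f = +-comm 0 (f 1)
∑-unfoldˡ (suc n) f rewrite ∑-unfoldˡ n f = +-assoc (f 1) _ _

∑-reverse : ∀ n f → ∑ n f ≡ ∑[ t ≤ n ] f (suc n ∸ t)
∑-reverse zero    f = refl
∑-reverse (suc n) f = begin
  ∑ n f + f (suc n)                      ≡⟨ cong (_+ f (suc n)) (∑-reverse n f) ⟩
  ∑[ t ≤ n ] f (suc n ∸ t) + f (suc n)   ≡⟨ +-comm _ (f (suc n)) ⟩
  f (suc n) + ∑[ t ≤ n ] f (suc n ∸ t)   ≡⟨ ∑-unfoldˡ n (λ t → f (suc (suc n) ∸ t)) ⟨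
  ∑[ t ≤ suc n ] f (suc (suc n) ∸ t)     ∎
  where open ≡-Reasoning

∣∑ : ∀ {k} n f → (∀ {t} → 1 ≤ t → t ≤ n → k ∣ f t) → k ∣ ∑ n f
∣∑ zero    f k∣f = _ ∣0
∣∑ (suc n) f k∣f = ∣m∣n⇒∣m+n (∣∑ n f (λ 1≤t t≤n → k∣f 1≤t (m≤n⇒m≤1+n t≤n))) (k∣f (s≤s z≤n) ≤-refl)

-- Divisibility

prime∤⇒coprime : ∀ {p n} → Prime p → ¬ p ∣ n → Coprime p n
prime∤⇒coprime p-prime p∤n (d∣p , d∣n) =
  [ (λ d≡1 → d≡1) , (λ { refl → ⊥-elim (p∤n d∣n) }) ]′ (prime⇒irreducible p-prime d∣p)

coprime⇒*∣ : ∀ {m n x} → Coprime m n → m ∣ x → n ∣ x → m * n ∣ x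
coprime⇒*∣ {m} {n} coprime (divides a refl) n∣am
  with coprime-divisor (Coprimality.sym coprime) (subst (n ∣_) (*-comm a m) n∣am)
... | divides b refl = divides b (xy∙z≈x∙zy b n m)

prime-power-lift : ∀ {p x i} k → Prime p → p ^ k ∣ x → i ∣ x → ¬ p ^ k ∣ i → i * p ∣ x
prime-power-lift zero _ _ _ p⁰∤i = ⊥-elim (p⁰∤i (1∣ _))
prime-power-lift {p} {x} {i} (suc k) p-prime pᵏ⁺¹∣x i∣x pᵏ⁺¹∤i with p ∣? i
... | no p∤i = subst (_∣ x) (*-comm p i)
  (coprime⇒*∣ (prime∤⇒coprime p-prime p∤i) (∣-trans (m∣m*n {p} (p ^ k)) pᵏ⁺¹∣x) i∣x)
... | yes (divides j refl) with ∣-trans (m∣m*n {p} (p ^ k)) pᵏ⁺¹∣x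
...   | divides y refl = *-monoˡ-∣ p (prime-power-lift k p-prime pᵏ∣y (*-cancelʳ-∣ p i∣x) pᵏ∤j)
  where
  instance _ = prime⇒nonZero p-prime
  pᵏ∣y : p ^ k ∣ y
  pᵏ∣y = *-cancelʳ-∣ p (subst (_∣ y * p) (*-comm p (p ^ k)) pᵏ⁺¹∣x)
  pᵏ∤j : ¬ p ^ k ∣ j
  pᵏ∤j pᵏ∣j = pᵏ⁺¹∤i (subst (_∣ j * p) (*-comm (p ^ k) p) (*-monoˡ-∣ p pᵏ∣j))

∤-offset : ∀ m {P t} → 0 < t → t < P → ¬ P ∣ m * P + t
∤-offset m {t = suc _} _ t<P P∣mP+t = >⇒∤ t<P (∣m+n∣m⇒∣n P∣mP+t (n∣m*n m))

÷-* : ∀ M j P .{{_ : NonZero P}} → M ÷ (j * P) ≡ M / P ÷ j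
÷-* M zero    P       = refl
÷-* M (suc j) (suc P) = trans (/-congʳ {m = M} (*-comm (suc j) (suc P))) (sym (m/n/o≡m/[n*o] M (suc P) (suc j)))

÷-pair : ∀ {N} x y .{{_ : NonZero x}} .{{_ : NonZero y}} → x ∣ N → y ∣ N →
  x * y * (N ÷ x + N ÷ y) ≡ (x + y) * N
÷-pair {N} x@(suc _) y@(suc _) x∣N y∣N = begin
  x * y * (N / x + N / y)             ≡⟨ regroup x y (N / x) (N / y) ⟩
  y * (N / x * x) + x * (N / y * y)   ≡⟨ cong₂ (λ a b → y * a + x * b) (m/n*n≡m x∣N) (m/n*n≡m y∣N) ⟩
  y * N + x * N                       ≡⟨ *-distribʳ-+ N y x ⟨
  (y + x) * N                         ≡⟨ cong (_* N) (+-comm y x) ⟩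
  (x + y) * N                         ∎
  where
  open ≡-Reasoning
  regroup : ∀ x y a b → x * y * (a + b) ≡ y * (a * x) + x * (b * y)
  regroup = solve-∀

prime∤* : ∀ {p m n} → Prime p → ¬ p ∣ m → ¬ p ∣ n → ¬ p ∣ m * n
prime∤* p-prime p∤m p∤n p∣mn = [ p∤m , p∤n ]′ (euclidsLemma _ _ p-prime p∣mn)

prime∣*⇒∣ʳ : ∀ {p m n} → Prime p → ¬ p ∣ m → p ∣ m * n → p ∣ n
prime∣*⇒∣ʳ p-prime p∤m p∣mn = [ (λ p∣m → ⊥-elim (p∤m p∣m)) , (λ p∣n → p∣n) ]′ (euclidsLemma _ _ p-prime p∣mn)

-- Pairing j with p - j: j (p - j) (N/j + N/(p - j)) = p N.
odd-prime∣∑÷ : ∀ {p N} → Prime p → 2 < p → (∀ {j} → 1 ≤ j → j < p → j ∣ N) →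
  p ∣ ∑[ j ≤ p ∸ 1 ] (N ÷ j)
odd-prime∣∑÷ {p@(suc p′)} {N} p-prime 2<p ∣N =
  prime∣*⇒∣ʳ p-prime (>⇒∤ 2<p) (subst (p ∣_) pairs≡2∑ (∣∑ p′ _ pair))
  where
  ∤-below : ∀ {j} → 1 ≤ j → j < p → ¬ p ∣ j
  ∤-below 1≤j j<p = >⇒∤ {{>-nonZero 1≤j}} j<p
  pair : ∀ {j} → 1 ≤ j → j ≤ p′ → p ∣ N ÷ j + N ÷ (p ∸ j)
  pair {j} 1≤j j≤p′ = prime∣*⇒∣ʳ p-prime (prime∤* p-prime (∤-below 1≤j (s≤s j≤p′)) (∤-below 1≤k k<p))
    (divides N (trans (÷-pair j k {{>-nonZero 1≤j}} {{>-nonZero 1≤k}} (∣N 1≤j (s≤s j≤p′)) (∣N 1≤k k<p))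
                      (trans (cong (_* N) (m+[n∸m]≡n (m≤n⇒m≤1+n j≤p′))) (*-comm p N))))
    where
    k = p ∸ j
    1≤k : 1 ≤ k
    1≤k = m<n⇒0<n∸m (s≤s j≤p′)
    k<p : k < p
    k<p = ∸-monoʳ-< 1≤j (m≤n⇒m≤1+n j≤p′)
  pairs≡2∑ : ∑[ j ≤ p′ ] (N ÷ j + N ÷ (p ∸ j)) ≡ 2 * ∑ p′ (N ÷_)
  pairs≡2∑ = begin
    ∑[ j ≤ p′ ] (N ÷ j + N ÷ (p ∸ j))      ≡⟨ ∑-distrib p′ (N ÷_) (λ j → N ÷ (p ∸ j)) ⟩
    ∑ p′ (N ÷_) + ∑[ j ≤ p′ ] (N ÷ (p ∸ j))  ≡⟨ cong (∑ p′ (N ÷_) +_) (∑-reverse p′ (N ÷_)) ⟨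
    ∑ p′ (N ÷_) + ∑ p′ (N ÷_)              ≡⟨ cong (∑ p′ (N ÷_) +_) (+-identityʳ _) ⟨
    2 * ∑ p′ (N ÷_)                        ∎
    where open ≡-Reasoning

prime∤product : ∀ {p qs} → Prime p → All Prime qs → All (p ≢_) qs → ¬ p ∣ product qs
prime∤product p-prime [] [] p∣1 = nonTrivial⇒≢1 {{prime⇒nonTrivial p-prime}} (∣1⇒≡1 p∣1)
prime∤product p-prime (q-prime ∷ qs-prime) (p≢q ∷ p≢qs) =
  prime∤* p-prime p∤q (prime∤product p-prime qs-prime p≢qs)
  where
  p∤q : ¬ _ ∣ _
  p∤q p∣q = [ nonTrivial⇒≢1 {{prime⇒nonTrivial p-prime}} , p≢q ]′ (prime⇒irreducible q-prime p∣q)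

distinct-primes⇒product∣ : ∀ {x ps} → All Prime ps → AllPairs _≢_ ps → All (_∣ x) ps → product ps ∣ x
distinct-primes⇒product∣ []                   []             []           = 1∣ _
distinct-primes⇒product∣ (p-prime ∷ ps-prime) (p≢ps ∷ ps≢) (p∣x ∷ ps∣x) =
  coprime⇒*∣ (prime∤⇒coprime p-prime (prime∤product p-prime ps-prime p≢ps)) p∣x
    (distinct-primes⇒product∣ ps-prime ps≢ ps∣x)

-- Harmonic numbers

∑-multiples : ∀ {k} m P .{{_ : NonZero P}} f → (∀ {t} → 1 ≤ t → t ≤ m * P → ¬ P ∣ t → k ∣ f t) →
  ∃ λ c → ∑ (m * P) f ≡ k * c + ∑[ j ≤ m ] f (j * P)
∑-multiples {k} zero P f off = 0 , sym (trans (+-identityʳ (k * 0)) (*-zeroʳ k))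
∑-multiples {k} (suc m) P@(suc P′) f off
  with ∑-multiples m P f (λ 1≤t t≤mP → off 1≤t (≤-trans t≤mP (m≤n+m (m * P) P)))
... | c , ∑≡ = c + quotient block , (begin
  ∑ (P + m * P) f                                    ≡⟨ cong (λ x → ∑ x f) (+-comm P (m * P)) ⟩
  ∑ (m * P + P) f                                    ≡⟨ ∑-+ (m * P) P f ⟩
  ∑ (m * P) f + (∑[ t ≤ P′ ] f (m * P + t) + f (m * P + P))
    ≡⟨ cong₂ (λ a b → a + (b + f (m * P + P))) ∑≡ (trans (_∣_.equality block) (*-comm _ k)) ⟩
  k * c + S + (k * quotient block + f (m * P + P))   ≡⟨ regroup k c S (quotient block) (f (m * P + P)) ⟩
  k * (c + quotient block) + (S + f (m * P + P))     ≡⟨ cong (λ x → k * (c + quotient block) + (S + f x)) (+-comm (m * P) P) ⟩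
  k * (c + quotient block) + (S + f (P + m * P))     ∎)
  where
  open ≡-Reasoning
  S = ∑[ j ≤ m ] f (j * P)
  block : k ∣ ∑[ t ≤ P′ ] f (m * P + t)
  block = ∣∑ P′ _ (λ {t} 1≤t t≤P′ → off (≤-trans 1≤t (m≤n+m t (m * P)))
    (subst (m * P + t ≤_) (+-comm (m * P) P) (+-monoʳ-≤ (m * P) (m≤n⇒m≤1+n t≤P′))) (∤-offset m 1≤t (s≤s t≤P′)))
  regroup : ∀ k c s c′ x → k * c + s + (k * c′ + x) ≡ k * (c + c′) + (s + x)
  regroup = solve-∀

odd-prime∣∑÷-window : ∀ {p k n M} → Prime p → 2 < p → (∀ {i} → 1 ≤ i → i ≤ n → i ∣ M) →
  (p ∸ 1) * p ^ k ≤ n → n < p ^ suc k → p ∣ ∑[ i ≤ n ] (M ÷ i)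
odd-prime∣∑÷-window {p@(suc p′)} {k} {n} {M} p-prime 2<p ∣M lower upper =
  subst (p ∣_) (sym split) (∣m∣n⇒∣m+n head tail)
  where
  P = p ^ k
  instance
    P≢0 : NonZero P
    P≢0 = m^n≢0 p k
  1≤P : 1 ≤ P
  1≤P = >-nonZero⁻¹ P
  r = n ∸ p′ * P
  split : ∑ n (M ÷_) ≡ ∑ (p′ * P) (M ÷_) + ∑[ t ≤ r ] (M ÷ (p′ * P + t))
  split = trans (cong (λ x → ∑ x (M ÷_)) (sym (m+[n∸m]≡n lower))) (∑-+ (p′ * P) r (M ÷_))
  ≤n : ∀ {t} → t ≤ p′ * P → t ≤ n
  ≤n t≤p′P = ≤-trans t≤p′P lower
  off : ∀ {t} → 1 ≤ t → t ≤ n → ¬ P ∣ t → p ∣ M ÷ t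
  off {suc t} _ t≤n P∤t = m*n∣o⇒n∣o/m (suc t) p
    (prime-power-lift k p-prime (∣M 1≤P P≤n) (∣M (s≤s z≤n) t≤n) P∤t)
    where
    P≤n : P ≤ n
    P≤n = ≤n (m≤n*m P p′ {{>-nonZero (≤-trans (s≤s z≤n) (≤-pred 2<p))}})
  multiples : p ∣ ∑[ j ≤ p′ ] (M ÷ (j * P))
  multiples = subst (p ∣_) (∑-cong p′ (λ j → sym (÷-* M j P))) (odd-prime∣∑÷ p-prime 2<p (λ {j} 1≤j j<p →
    m*n∣o⇒m∣o/n j P (∣M (*-mono-≤ 1≤j 1≤P) (≤n (*-monoˡ-≤ P (≤-pred j<p))))))
  head : p ∣ ∑ (p′ * P) (M ÷_)
  head with ∑-multiples p′ P (M ÷_) (λ 1≤t t≤p′P → off 1≤t (≤n t≤p′P))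
  ... | c , ∑≡ = subst (p ∣_) (sym ∑≡) (∣m∣n⇒∣m+n (m∣m*n c) multiples)
  tail : p ∣ ∑[ t ≤ r ] (M ÷ (p′ * P + t))
  tail = ∣∑ r _ (λ {t} 1≤t t≤r → off (≤-trans 1≤t (m≤n+m t (p′ * P)))
    (subst (p′ * P + t ≤_) (m+[n∸m]≡n lower) (+-monoʳ-≤ (p′ * P) t≤r)) (∤-offset p′ 1≤t (≤-<-trans t≤r r<P)))
    where
    r<P : r < P
    r<P = subst (r <_) (m+n∸n≡m P (p′ * P)) (∸-monoˡ-< upper lower)

module _ where
  -- Opened locally: the injection +_ would make sections such as (x +_) ambiguous.
  open import Data.Integer using (+_)

  numerator-coprime : (x : ℚ) → Coprime ℤ.∣ ↥ x ∣ (↧ₙ x)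
  numerator-coprime (mkℚ _ _ coprime) = Coprimality.recompute coprime

  +-reciprocal : ∀ s k M → suc k ∣ suc M →
    mkℚᵘ (+ s) M ℚᵘ.+ mkℚᵘ (+ 1) k ≃ mkℚᵘ (+ (s + suc M / suc k)) M
  +-reciprocal s k M (divides c eq) = *≡* (begin
    (+ s ℤ.* + suc k ℤ.+ + 1 ℤ.* + suc M) ℤ.* + suc M
      ≡⟨ cong₂ (λ a b → (a ℤ.+ b) ℤ.* + suc M) (ℤ.pos-* s (suc k)) (sym (ℤ.*-identityˡ (+ suc M))) ⟨
    (+ (s * suc k) ℤ.+ + suc M) ℤ.* + suc M
      ≡⟨ cong (ℤ._* + suc M) (ℤ.pos-+ (s * suc k) (suc M)) ⟨
    + (s * suc k + suc M) ℤ.* + suc M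
      ≡⟨ ℤ.pos-* (s * suc k + suc M) (suc M) ⟨
    + ((s * suc k + suc M) * suc M)
      ≡⟨ cong +_ (cross-multiplied s c (suc k) (suc M) eq) ⟩
    + ((s + c) * (suc M * suc k))
      ≡⟨ cong (λ c → + ((s + c) * (suc M * suc k))) quotient≡ ⟨
    + ((s + suc M / suc k) * (suc M * suc k))
      ≡⟨ ℤ.pos-* (s + suc M / suc k) (suc M * suc k) ⟩
    + (s + suc M / suc k) ℤ.* + (suc M * suc k) ∎)
    where
    open ≡-Reasoning
    quotient≡ : suc M / suc k ≡ c
    quotient≡ = trans (cong (_/ suc k) eq) (m*n/n≡m c (suc k))
    cross-multiplied : ∀ s c k M → M ≡ c * k → (s * k + M) * M ≡ (s + c) * (M * k)
    cross-multiplied s c k _ refl = identity s c k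
      where
      identity : ∀ s c k → (s * k + c * k) * (c * k) ≡ (s + c) * (c * k * k)
      identity = solve-∀

  H≃∑÷ : ∀ n M → (∀ {i} → 1 ≤ i → i ≤ n → i ∣ suc M) →
    toℚᵘ (H n) ≃ mkℚᵘ (+ ∑[ i ≤ n ] (suc M ÷ i)) M
  H≃∑÷ zero    M ∣M = *≡* refl
  H≃∑÷ (suc n) M ∣M =
    ≃-trans (toℚᵘ-homo-+ (H n) (recipSuc n))
    (≃-trans (+ᵘ-cong (H≃∑÷ n M (λ 1≤i i≤n → ∣M 1≤i (m≤n⇒m≤1+n i≤n))) (toℚᵘ-fromℚᵘ (mkℚᵘ (+ 1) n)))
             (+-reciprocal _ n M (∣M (s≤s z≤n) ≤-refl)))

  H-cross-multiplied : ∀ n M .{{_ : NonZero M}} → (∀ {i} → 1 ≤ i → i ≤ n → i ∣ M) →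
    ℤ.∣ ↥ (H n) ∣ * M ≡ ∑[ i ≤ n ] (M ÷ i) * d n
  H-cross-multiplied n (suc M) ∣M with H≃∑÷ n M ∣M
  ... | *≡* eq = begin
    ℤ.∣ ↥ (H n) ∣ * suc M                   ≡⟨ ℤ.abs-* (↥ (H n)) (+ suc M) ⟨
    ℤ.∣ ↥ (H n) ℤ.* + suc M ∣               ≡⟨ cong (λ a → ℤ.∣ a ℤ.* + suc M ∣) (↥ᵘ-toℚᵘ (H n)) ⟨
    ℤ.∣ ℚᵘ.↥ toℚᵘ (H n) ℤ.* + suc M ∣       ≡⟨ cong ℤ.∣_∣ eq ⟩
    ℤ.∣ + S ℤ.* ℚᵘ.↧ toℚᵘ (H n) ∣           ≡⟨ cong (λ b → ℤ.∣ + S ℤ.* b ∣) (↧ᵘ-toℚᵘ (H n)) ⟩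
    ℤ.∣ + S ℤ.* ↧ (H n) ∣                   ≡⟨ ℤ.abs-* (+ S) (↧ (H n)) ⟩
    S * d n                                 ∎
    where
    open ≡-Reasoning
    S = ∑[ i ≤ n ] (suc M ÷ i)

  -- Cancelling p gives c (M/p) = (S/p) d, and d ∣ M/p since c and d are coprime.
  ∣-reduced-cofactor : ∀ (x : ℚ) {M S p} .{{_ : NonZero p}} →
    ℤ.∣ ↥ x ∣ * M ≡ S * ↧ₙ x → p ∣ M → p ∣ S → p ∣ M / ↧ₙ x
  ∣-reduced-cofactor x {p = p} cross (divides m refl) (divides s refl) =
    cofactor (coprime-divisor (Coprimality.sym (numerator-coprime x)) (divides s cm≡sd))
    where
    open ≡-Reasoning
    cm≡sd : ℤ.∣ ↥ x ∣ * m ≡ s * ↧ₙ x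
    cm≡sd = *-cancelʳ-≡ _ _ p (begin
      ℤ.∣ ↥ x ∣ * m * p   ≡⟨ *-assoc ℤ.∣ ↥ x ∣ m p ⟩
      ℤ.∣ ↥ x ∣ * (m * p) ≡⟨ cross ⟩
      s * p * ↧ₙ x        ≡⟨ xy∙z≈xz∙y s p (↧ₙ x) ⟩
      s * ↧ₙ x * p        ∎)
    cofactor : ↧ₙ x ∣ m → p ∣ m * p / ↧ₙ x
    cofactor (divides t refl) = divides t (begin
      t * ↧ₙ x * p / ↧ₙ x   ≡⟨ cong (_/ ↧ₙ x) (xy∙z≈xz∙y t (↧ₙ x) p) ⟩
      t * p * ↧ₙ x / ↧ₙ x   ≡⟨ m*n/n≡m (t * p) (↧ₙ x) ⟩
      t * p                 ∎)

lcm-nonZero : ∀ m n .{{_ : NonZero m}} .{{_ : NonZero n}} → NonZero (lcm m n)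
lcm-nonZero m n = m*n≢0⇒n≢0 (gcd m n) {{subst NonZero (sym (gcd*lcm m n)) (m*n≢0 m n)}}

D-nonZero : ∀ n → NonZero (D n)
D-nonZero zero    = _
D-nonZero (suc n) = lcm-nonZero (D n) (suc n) {{D-nonZero n}}

∣D : ∀ {i} n → 1 ≤ i → i ≤ n → i ∣ D n
∣D zero    (s≤s z≤n) ()
∣D (suc n) 1≤i i≤1+n with m≤n⇒m<n∨m≡n i≤1+n
... | inj₁ i<1+n = ∣-trans (∣D n 1≤i (≤-pred i<1+n)) (m∣lcm[m,n] (D n) (suc n))
... | inj₂ refl  = n∣lcm[m,n] (D n) (suc n)

∣D∧∣∑⇒∣q : ∀ n {p} .{{_ : NonZero p}} → p ∣ D n → p ∣ ∑[ i ≤ n ] (D n ÷ i) → p ∣ q n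
∣D∧∣∑⇒∣q n = ∣-reduced-cofactor (H n) (H-cross-multiplied n (D n) {{D-nonZero n}} (∣D n))

-- Simultaneous approximation

⌈log[_]_⌉ : ℕ → ℕ → ℕ
⌈log[ p ] zero  ⌉ = 0
⌈log[ p ] suc x ⌉ with suc x ≤? p ^ ⌈log[ p ] x ⌉
... | yes _ = ⌈log[ p ] x ⌉
... | no  _ = suc ⌈log[ p ] x ⌉

⌈log⌉-bracket : ∀ {p} → 2 ≤ p → ∀ x .{{_ : NonZero x}} → x ≤ p ^ ⌈log[ p ] x ⌉ × p ^ ⌈log[ p ] x ⌉ < p * x
⌈log⌉-bracket 2≤p (suc x) = bracket 2≤p x
  where
  bracket : ∀ {p} → 2 ≤ p → ∀ x → suc x ≤ p ^ ⌈log[ p ] suc x ⌉ × p ^ ⌈log[ p ] suc x ⌉ < p * suc x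
  bracket {p} 2≤p zero = ≤-refl , subst (1 <_) (sym (*-identityʳ p)) 2≤p
  bracket {p} 2≤p (suc x) with suc (suc x) ≤? p ^ ⌈log[ p ] suc x ⌉ | bracket 2≤p x
  ... | yes 2+x≤pᶜ | _ , pᶜ<p[1+x] = 2+x≤pᶜ , <-≤-trans pᶜ<p[1+x] (*-monoʳ-≤ p (n≤1+n (suc x)))
  ... | no  2+x≰pᶜ | 1+x≤pᶜ , _ rewrite ≤-antisym (≤-pred (≰⇒> 2+x≰pᶜ)) 1+x≤pᶜ =
    ≤-trans (s≤s (m≤n+m (suc x) x)) (subst (_≤ p * suc x) (cong (suc x +_) (+-identityʳ (suc x))) (*-monoˡ-≤ (suc x) 2≤p)) ,
    *-monoʳ-< p {{>-nonZero (<-trans (s≤s z≤n) 2≤p)}} ≤-refl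

⌈log⌉-step : ∀ p x → ⌈log[ p ] x ⌉ ≤ ⌈log[ p ] suc x ⌉
⌈log⌉-step p x with suc x ≤? p ^ ⌈log[ p ] x ⌉
... | yes _ = ≤-refl
... | no  _ = n≤1+n _

⌈log⌉-mono-≤ : ∀ p {x y} → x ≤ y → ⌈log[ p ] x ⌉ ≤ ⌈log[ p ] y ⌉
⌈log⌉-mono-≤ p {y = zero}  z≤n = ≤-refl
⌈log⌉-mono-≤ p {y = suc y} x≤1+y with m≤n⇒m<n∨m≡n x≤1+y
... | inj₁ x<1+y = ≤-trans (⌈log⌉-mono-≤ p (≤-pred x<1+y)) (⌈log⌉-step p y)
... | inj₂ refl  = ≤-refl

infix 4 _≲[_]_

-- y ≲[ u ] x means y < (1 + 1/u) x.
_≲[_]_ : ℕ → ℕ → ℕ → Set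
y ≲[ u ] x = u * y < suc u * x

NearlyEqual : ℕ → ℕ → ℕ → Set
NearlyEqual b y x = ∃ λ u → b ≤ u × y ≲[ u ] x × x ≲[ u ] y

≲⇒0< : ∀ {y u x} → y ≲[ u ] x → 0 < x
≲⇒0< {y} {u} {zero} y≲x = ⊥-elim (n≮0 (subst (u * y <_) (*-zeroʳ (suc u)) y≲x))
≲⇒0< {x = suc _} _   = s≤s z≤n

≲-weaken : ∀ {y u x v} → v ≤ u → y ≲[ u ] x → y ≲[ v ] x
≲-weaken {y} {u} {x} {zero} _ y≲x = subst (0 <_) (sym (+-identityʳ x)) (≲⇒0< {y} {u} y≲x)
≲-weaken {y} {u} {x} {v@(suc _)} v≤u y≲x = *-cancelˡ-< u _ _ (begin-strict
  u * (v * y)       ≡⟨ x∙yz≈y∙xz u v y ⟩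
  v * (u * y)       <⟨ *-monoʳ-< v {u * y} {suc u * x} y≲x ⟩
  v * (suc u * x)   ≡⟨ *-assoc v (suc u) x ⟨
  v * suc u * x     ≤⟨ *-monoˡ-≤ x v[1+u]≤u[1+v] ⟩
  u * suc v * x     ≡⟨ *-assoc u (suc v) x ⟩
  u * (suc v * x)   ∎)
  where
  open ≤-Reasoning
  v[1+u]≤u[1+v] : v * suc u ≤ u * suc v
  v[1+u]≤u[1+v] = begin
    v * suc u   ≡⟨ *-suc v u ⟩
    v + v * u   ≤⟨ +-monoˡ-≤ (v * u) v≤u ⟩
    u + v * u   ≡⟨ cong (u +_) (*-comm v u) ⟩
    u + u * v   ≡⟨ *-suc u v ⟨
    u * suc v   ∎

-- (1 + 1/u)(1 + 1/v) < 1 + 1/w as soon as u, v ≥ 2(w + 1).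
*-suc-suc< : ∀ w {u v} → 2 * suc w ≤ u → 2 * suc w ≤ v → w * (suc u * suc v) < suc w * (u * v)
*-suc-suc< w u≥ v≥ with a , refl ← m≤n⇒∃[o]m+o≡n u≥ | c , refl ← m≤n⇒∃[o]m+o≡n v≥ =
  <-≤-trans (m<m+n _ (s≤s z≤n)) (≤-reflexive (sym (slack w a c)))
  where
  slack : ∀ w a c → suc w * ((2 * suc w + a) * (2 * suc w + c))
                  ≡ w * (suc (2 * suc w + a) * suc (2 * suc w + c)) + (4 + 3 * w + (2 + w) * (a + c) + a * c)
  slack = solve-∀

≲-trans : ∀ {z u y v x} w → 2 * suc w ≤ u → 2 * suc w ≤ v → z ≲[ u ] y → y ≲[ v ] x → z ≲[ w ] x
≲-trans {z} {u} {y} {v} {x} w u≥ v≥ z≲y y≲x = *-cancelˡ-< (u * v) _ _ (begin-strict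
  u * v * (w * z)             ≡⟨ lhs u v w z ⟩
  w * v * (u * z)             ≤⟨ *-monoʳ-≤ (w * v) (<⇒≤ z≲y) ⟩
  w * v * (suc u * y)         ≡⟨ mid w v (suc u) y ⟩
  w * suc u * (v * y)         ≤⟨ *-monoʳ-≤ (w * suc u) (<⇒≤ y≲x) ⟩
  w * suc u * (suc v * x)     ≡⟨ rhs w (suc u) (suc v) x ⟩
  w * (suc u * suc v) * x     <⟨ *-monoˡ-< x {{>-nonZero (≲⇒0< {y} {v} y≲x)}} (*-suc-suc< w u≥ v≥) ⟩
  suc w * (u * v) * x         ≡⟨ end (suc w) u v x ⟩
  u * v * (suc w * x)         ∎)
  where
  open ≤-Reasoning
  lhs : ∀ u v w z → u * v * (w * z) ≡ w * v * (u * z)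
  lhs = solve-∀
  mid : ∀ w v u y → w * v * (u * y) ≡ w * u * (v * y)
  mid = solve-∀
  rhs : ∀ w u v x → w * u * (v * x) ≡ w * (u * v) * x
  rhs = solve-∀
  end : ∀ w u v x → w * (u * v) * x ≡ u * v * (w * x)
  end = solve-∀

≲-from-common-floor : ∀ {u r a x y} → 0 < y →
  u * r ≤ a → a < suc u * r → u * (r * x) ≤ a * y → a * y < suc u * (r * x) → y ≲[ u ] x × x ≲[ u ] y
≲-from-common-floor {u} {r} {a} {x} {y} 0<y ur≤a a<[1+u]r urx≤ay ay<[1+u]rx = y≲x , x≲y
  where
  open ≤-Reasoning
  y≲x : y ≲[ u ] x
  y≲x = *-cancelˡ-< r _ _ (begin-strict
    r * (u * y)       ≡⟨ x∙yz≈yx∙z r u y ⟩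
    u * r * y         ≤⟨ *-monoˡ-≤ y ur≤a ⟩
    a * y             <⟨ ay<[1+u]rx ⟩
    suc u * (r * x)   ≡⟨ x∙yz≈y∙xz (suc u) r x ⟩
    r * (suc u * x)   ∎)
  x≲y : x ≲[ u ] y
  x≲y = *-cancelˡ-< r _ _ (begin-strict
    r * (u * x)       ≡⟨ x∙yz≈y∙xz r u x ⟩
    u * (r * x)       ≤⟨ urx≤ay ⟩
    a * y             <⟨ *-monoˡ-< y {{>-nonZero 0<y}} a<[1+u]r ⟩
    suc u * r * y     ≡⟨ xy∙z≈y∙xz (suc u) r y ⟩
    r * (suc u * y)   ∎)

radix-bound : ∀ {d m c M} → d < m → c < M → d + m * c < m * M
radix-bound {d} {m} {c} {M} d<m c<M = <-≤-trans (+-monoˡ-< (m * c) d<m) (subst (_≤ m * M) (*-suc m c) (*-monoʳ-≤ m c<M))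

radix-injective : ∀ {d d′ m c c′} → d < m → d′ < m → d + m * c ≡ d′ + m * c′ → d ≡ d′ × c ≡ c′
radix-injective {d} {d′} {m} {c} {c′} d<m d′<m eq =
  d≡d′ , *-cancelˡ-≡ c c′ m (+-cancelˡ-≡ d _ _ (trans eq (cong (_+ m * c′) (sym d≡d′))))
  where
  instance _ = >-nonZero (<-≤-trans (s≤s z≤n) d<m)
  digit : ∀ {e} k → e < m → (e + m * k) % m ≡ e
  digit {e} k e<m = trans (cong (λ t → (e + t) % m) (*-comm m k)) (trans ([m+kn]%n≡m%n e k m) (m<n⇒m%n≡m e<m))
  d≡d′ : d ≡ d′
  d≡d′ = trans (sym (digit c d<m)) (trans (cong (_% m) eq) (digit c′ d′<m))

module _ {A : Set} (f : A → ℕ → ℕ) (N : A → ℕ) where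

  private
    Bounded : A → Set
    Bounded x = ∀ a → f x a < N x

    code : List A → ℕ → ℕ
    code []       a = 0
    code (x ∷ xs) a = f x a + N x * code xs a

    size : List A → ℕ
    size []       = 1
    size (x ∷ xs) = N x * size xs

    code< : ∀ {xs} → All Bounded xs → ∀ a → code xs a < size xs
    code< []           a = s≤s z≤n
    code< (fx< ∷ fxs<) a = radix-bound (fx< a) (code< fxs< a)

    code-injective : ∀ {xs a a′} → All Bounded xs → code xs a ≡ code xs a′ → All (λ x → f x a ≡ f x a′) xs
    code-injective []                   _  = []
    code-injective {a = a} {a′} (fx< ∷ fxs<) eq with radix-injective (fx< a) (fx< a′) eq
    ... | fx≡ , codes≡ = fx≡ ∷ code-injective fxs< codes≡

  simultaneous-pigeonhole : ∀ xs → All Bounded xs → ∃₂ λ a₀ a₁ → a₀ < a₁ × All (λ x → f x a₀ ≡ f x a₁) xs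
  simultaneous-pigeonhole xs bounded with pigeonhole (n<1+n (size xs)) (λ i → fromℕ< (code< bounded (toℕ i)))
  ... | i , j , i<j , same = toℕ i , toℕ j , i<j ,
    code-injective bounded (trans (sym (toℕ-fromℕ< _)) (trans (cong toℕ same) (toℕ-fromℕ< _)))

m<[1+m/n]*n : ∀ m n .{{_ : NonZero n}} → m < suc (m / n) * n
m<[1+m/n]*n m n = subst (_< suc (m / n) * n) (sym (m≡m%n+[m/n]*n m n)) (+-monoˡ-< (m / n * n) (m%n<n m n))

^-split : ∀ m {n o} → n ≤ o → m ^ o ≡ m ^ n * m ^ (o ∸ n)
^-split m {n} n≤o = trans (cong (m ^_) (sym (m+[n∸m]≡n n≤o))) (^-distribˡ-+-* m n _)

-- ratio p a / b approximates p^(E p a) / b^a ∈ [1, p), where p^(E p a) is the least power of p above b^a.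
module PowerRatios (b : ℕ) .{{_ : NonZero b}} where

  E : ℕ → ℕ → ℕ
  E p a = ⌈log[ p ] b ^ a ⌉

  ratio : ℕ → ℕ → ℕ
  ratio p a = (b * p ^ E p a / b ^ a) {{m^n≢0 b a}}

  module _ {p} (2≤p : 2 ≤ p) (a : ℕ) where

    private instance
      b^a≢0 : NonZero (b ^ a)
      b^a≢0 = m^n≢0 b a

    ratio-floor : ratio p a * b ^ a ≤ b * p ^ E p a
    ratio-floor = m/n*n≤m (b * p ^ E p a) (b ^ a)

    ratio-ceil : b * p ^ E p a < suc (ratio p a) * b ^ a
    ratio-ceil = m<[1+m/n]*n (b * p ^ E p a) (b ^ a)

    b≤ratio : b ≤ ratio p a
    b≤ratio = subst (_≤ ratio p a) (m*n/n≡m b (b ^ a))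
      (/-monoˡ-≤ (b ^ a) (*-monoʳ-≤ b (proj₁ (⌈log⌉-bracket 2≤p (b ^ a)))))

    ratio< : ratio p a < p * b
    ratio< = m<n*o⇒m/o<n (subst (b * p ^ E p a <_) (x∙yz≈yx∙z b p (b ^ a))
      (*-monoʳ-< b (proj₂ (⌈log⌉-bracket 2≤p (b ^ a)))))

  ratio-close : ∀ {p a₀ a₁} → 2 ≤ p → a₀ ≤ a₁ → ratio p a₀ ≡ ratio p a₁ →
    p ^ (E p a₁ ∸ E p a₀) ≲[ ratio p a₀ ] b ^ (a₁ ∸ a₀) × b ^ (a₁ ∸ a₀) ≲[ ratio p a₀ ] p ^ (E p a₁ ∸ E p a₀)
  ratio-close {p} {a₀} {a₁} 2≤p a₀≤a₁ same =
    ≲-from-common-floor {ratio p a₀} {b ^ a₀} {b * p ^ E p a₀} {b ^ (a₁ ∸ a₀)} {p ^ (E p a₁ ∸ E p a₀)}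
      (m^n>0 p {{>-nonZero (<-trans (s≤s z≤n) 2≤p)}} (E p a₁ ∸ E p a₀)) (ratio-floor 2≤p a₀) (ratio-ceil 2≤p a₀)
      (subst₂ (λ r t → ratio p a₀ * r ≤ t) b^a₁≡ bp^E₁≡
        (subst (λ u → u * b ^ a₁ ≤ _) (sym same) (ratio-floor 2≤p a₁)))
      (subst₂ (λ t r → t < suc (ratio p a₀) * r) bp^E₁≡ b^a₁≡
        (subst (λ u → _ < suc u * b ^ a₁) (sym same) (ratio-ceil 2≤p a₁)))
    where
    b^a₁≡ : b ^ a₁ ≡ b ^ a₀ * b ^ (a₁ ∸ a₀)
    b^a₁≡ = ^-split b a₀≤a₁
    bp^E₁≡ : b * p ^ E p a₁ ≡ b * p ^ E p a₀ * p ^ (E p a₁ ∸ E p a₀)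
    bp^E₁≡ = trans (cong (b *_) (^-split p (⌈log⌉-mono-≤ p (^-monoʳ-≤ b a₀≤a₁)))) (sym (*-assoc b _ _))

  powers-nearly-equal : ∀ ps → All (2 ≤_) ps →
    ∃ λ G → ∃ λ (F : ℕ → ℕ) → 1 ≤ G × All (λ p → NearlyEqual b (p ^ F p) (b ^ G)) ps
  powers-nearly-equal ps 2≤ps with simultaneous-pigeonhole ratio (λ p → p * b) ps (All.map (λ 2≤p → ratio< 2≤p) 2≤ps)
  ... | a₀ , a₁ , a₀<a₁ , same = a₁ ∸ a₀ , (λ p → E p a₁ ∸ E p a₀) , m<n⇒0<n∸m a₀<a₁ ,
    All.zipWith (λ {p} (2≤p , same) → ratio p a₀ , b≤ratio 2≤p a₀ , ratio-close 2≤p (<⇒≤ a₀<a₁) same) (2≤ps , same)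

Window : ℕ → ℕ → Set
Window p n = ∃ λ k → (p ∸ 1) * p ^ suc k ≤ n × n < p ^ suc (suc k)

window-below-power : ∀ {p F m} → 2 ≤ p → p < p ^ F → p ^ F ≲[ p ∸ 1 ] m → m ≤ p ^ F → Window p (pred m)
window-below-power {p@(suc _)} {zero} _ p<1 _ _ = ⊥-elim (<⇒≱ p<1 (s≤s z≤n))
window-below-power {p@(suc _)} {suc zero} _ p<p _ _ = ⊥-elim (<-irrefl (sym (*-identityʳ p)) p<p)
window-below-power {p@(suc p′)} {suc (suc k)} {m} _ _ Y≲m m≤Y =
  k , <⇒≤pred p′Z<m , subst (_≤ p ^ suc (suc k)) (sym (suc-pred m {{m≢0}})) m≤Y
  where
  Z = p ^ suc k
  m≢0 : NonZero m
  m≢0 = >-nonZero (≲⇒0< {p ^ suc (suc k)} {p′} Y≲m)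
  p′Z<m : p′ * Z < m
  p′Z<m = *-cancelˡ-< p _ _ (subst (_< p * m) (x∙yz≈y∙xz p′ p Z) Y≲m)

module _ {b X : ℕ} (F : ℕ → ℕ) where

  private
    Y : ℕ → ℕ
    Y p = p ^ F p

  min-in-windows : ∀ ps → All (2 <_) ps → 2 ≤ b → All (λ p → 2 * p < b) ps → b ≤ X →
    All (λ p → NearlyEqual b (Y p) X) ps → 1 < min X (map Y ps) × All (λ p → Window p (pred (min X (map Y ps)))) ps
  min-in-windows ps 2<ps 2≤b 2p<b b≤X near = 1<m , All.tabulate window
    where
    m = min X (map Y ps)
    2p≤ : ∀ {p v} → p ∈ ps → b ≤ v → 2 * suc (p ∸ 1) ≤ v
    2p≤ {p} {v} p∈ps b≤v = subst (λ x → 2 * x ≤ v) (sym (m+[n∸m]≡n {1} (≤-trans (s≤s z≤n) (All.lookup 2<ps p∈ps))))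
      (≤-trans (<⇒≤ (All.lookup 2p<b p∈ps)) b≤v)
    p<Y : ∀ {p} → p ∈ ps → NearlyEqual b (Y p) X → p < Y p
    p<Y p∈ps (u , b≤u , _ , X≲Y) = *-cancelˡ-< 2 _ _ (<-trans (<-≤-trans (All.lookup 2p<b p∈ps) b≤X)
      (subst (_< 2 * Y _) (+-identityʳ X) (≲-weaken {X} {u} (≤-trans (≤-trans (s≤s z≤n) 2≤b) b≤u) X≲Y)))
    Y≲m : ∀ {p} → p ∈ ps → NearlyEqual b (Y p) X → Y p ≲[ p ∸ 1 ] m
    Y≲m {p} p∈ps (u , b≤u , Y≲X , _) = argmin-all id {P = Y p ≲[ p ∸ 1 ]_}
      (≲-weaken {Y p} {u} (≤-trans (m≤n⇒m≤1+n ≤-refl) (≤-trans (m≤m+n _ (suc (p ∸ 1) + 0)) (2p≤ p∈ps b≤u))) Y≲X)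
      (map⁺ (All.map (λ (v , b≤v , _ , X≲Yq) → ≲-trans (p ∸ 1) (2p≤ p∈ps b≤u) (2p≤ p∈ps b≤v) Y≲X X≲Yq) near))
    window : ∀ {p} → p ∈ ps → Window p (pred m)
    window {p} p∈ps = window-below-power {F = F p} (<⇒≤ (All.lookup 2<ps p∈ps)) (p<Y p∈ps (All.lookup near p∈ps))
      (Y≲m p∈ps (All.lookup near p∈ps)) (All.lookup (map⁻ (min≤xs X (map Y ps))) p∈ps)
    1<m : 1 < m
    1<m = v<min⁺ (≤-trans 2≤b b≤X) (map⁺ (All.tabulate λ p∈ps →
      <-trans (<-trans (s≤s (s≤s z≤n)) (All.lookup 2<ps p∈ps)) (p<Y p∈ps (All.lookup near p∈ps))))

∃-common-window : ∀ ps → All (2 <_) ps → ∃ λ n → 0 < n × All (λ p → Window p n) ps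
∃-common-window ps 2<ps =
  let G , F , 1≤G , near = powers-nearly-equal ps (All.map <⇒≤ 2<ps)
      1<m , windows = min-in-windows F ps 2<ps (s≤s (s≤s z≤n)) 2p<b (subst (_≤ b ^ G) (*-identityʳ b) (^-monoʳ-≤ b 1≤G)) near
  in pred (min (b ^ G) (map (λ p → p ^ F p) ps)) , <⇒≤pred 1<m , windows
  where
  -- b > 2p for every p in ps, and b ≥ 2 so that its powers grow.
  b = 3 + 2 * max 0 ps
  open PowerRatios b
  2p<b : All (λ p → 2 * p < b) ps
  2p<b = All.map (λ p≤L → s≤s (≤-trans (*-monoʳ-≤ 2 p≤L) (m≤n+m _ 2))) (xs≤max 0 ps)

window⇒prime∣q : ∀ {p n} → Prime p → 2 < p → Window p n → p ∣ q n
window⇒prime∣q {p@(suc p′)} {n} p-prime 2<p (k , lower , upper) =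
  ∣D∧∣∑⇒∣q n {{prime⇒nonZero p-prime}} (∣-trans (m∣m*n (p ^ k)) (∣D n (m^n>0 p (suc k)) pᵏ⁺¹≤n))
    (odd-prime∣∑÷-window {k = suc k} p-prime 2<p (∣D n) lower upper)
  where
  pᵏ⁺¹≤n : p ^ suc k ≤ n
  pᵏ⁺¹≤n = ≤-trans (m≤n*m (p ^ suc k) p′ {{>-nonZero (≤-trans (s≤s z≤n) (≤-pred 2<p))}}) lower

theorem4 : (ps : List ℕ) → All Prime ps → All (2 <_) ps → Linked _<_ ps →
    ∃ λ n → (0 < n) × (product ps ∣ q n)
theorem4 ps ps-prime 2<ps increasing =
  let n , 0<n , windows = ∃-common-window ps 2<ps in
  n , 0<n , distinct-primes⇒product∣ ps-prime (AllPairs.map <⇒≢ (Linked⇒AllPairs <-trans increasing))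
    (All.tabulate λ p∈ps →
      window⇒prime∣q (All.lookup ps-prime p∈ps) (All.lookup 2<ps p∈ps) (All.lookup windows p∈ps))
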